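{- Let $q$ be a power of an odd prime $p$, let $\ell$ be a linearized polynomial over $\mathbb F_{q^2}$, and let $\mathrm{N}:\mathbb F_{q^2}\to\mathbb F_q$, $\mathrm N(u)=u^{q+1}$, be the norm. Then the function $f(x)=x^{q+1}+\ell(x^2)$ is a planar function on $\mathbb F_{q^2}$ if and only if $\ell(u)^2-\mathrm N(u)$ is a nonzero square in $\mathbb F_q$ for all $u\in\mathbb F_{q^2}^*$ such that $\ell(u)\in\mathbb F_q$.
   Context: A linearized polynomial over $\mathbb F_{q^n}$ is a polynomial of the form $\sum_i b_i x^{p^i}$ with coefficients $b_i\in\mathbb F_{q^n}$; it induces an $\mathbb F_p$-linear endomorphism of $\mathbb F_{q^n}$. A function $f$ on $\mathbb F_{q^n}$ (given by a polynomial over $\mathbb F_{q^n}$) is planar if for every $c\in\mathbb F_{q^n}^*$ the map $x\mapsto f(x+c)-f(x)$ is a permutation of $\mathbb F_{q^n}$. -}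

module Defs where

open import Level using (Level)
open import Data.Nat using (ℕ; suc) renaming (_+_ to _+ℕ_; _^_ to _^ℕ_)
open import Data.Fin using (Fin)
open import Data.List using (List; []; _∷_)
open import Data.Product using (_×_; Σ; ∃; ∃-syntax)
open import Relation.Binary.PropositionalEquality using (_≡_)
open import Algebra.Bundles using (CommutativeRing; Semiring)
open import Function.Definitions using (Bijective)

module FieldTheory {c ℓ : Level} (R : CommutativeRing c ℓ) where
  open CommutativeRing R
  open import Algebra.Definitions.RawSemiring (Semiring.rawSemiring semiring) public using (_^_)
  open import Algebra.Definitions.RawMonoid +-rawMonoid public using () renaming (_×_ to _·1_)

  IsField : Set (c Level.⊔ ℓ)
  IsField = (1# ≉ 0#) × (∀ x → x ≉ 0# → ∃[ y ] (x * y ≈ 1#))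

  HasOrder : ℕ → Set (c Level.⊔ ℓ)
  HasOrder n = Σ (Fin n → Carrier) (Bijective _≡_ _≈_)

  CharDivides : ℕ → Set ℓ
  CharDivides p = (p ·1 1#) ≈ 0#

  InSubfield : ℕ → Carrier → Set ℓ
  InSubfield q u = u ^ q ≈ u

  -- Linearized polynomial with coefficient list b₀, b₁, … :
  --   ℓ(x) = Σ_i b_i x^(p^i)
  linEvalFrom : ℕ → ℕ → List Carrier → Carrier → Carrier
  linEvalFrom p i [] x = 0#
  linEvalFrom p i (b ∷ bs) x = b * (x ^ (p ^ℕ i)) + linEvalFrom p (suc i) bs x

  linEval : ℕ → List Carrier → Carrier → Carrier
  linEval p bs x = linEvalFrom p 0 bs x

  Norm : ℕ → Carrier → Carrier
  Norm q u = u ^ (q +ℕ 1)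

  Planar : (Carrier → Carrier) → Set (c Level.⊔ ℓ)
  Planar f = ∀ a → a ≉ 0# → Bijective _≈_ _≈_ (λ x → f (x + a) - f x)

  NonzeroSquareIn : ℕ → Carrier → Set (c Level.⊔ ℓ)
  NonzeroSquareIn q a = (a ≉ 0#) × ∃[ y ] (InSubfield q y × (y * y ≈ a))

{-# OPTIONS --safe #-}
module Submission where

-- Write f(x + a) − f(x) = Λₐ(x) + f(a), where Λₐ(x) = a x^q + a^q x + 2ℓ(ax) is additive in x. As the field
-- is finite, f is planar iff no Λₐ with a ≠ 0 has a nonzero root. For a root x put u = ax and w = a^q x: then
-- w + w^q = −2ℓ(u) and w^(q+1) = N(u), so w and w^q are the roots of X² + 2ℓ(u)X + N(u). Conversely, such a w
-- with u ≠ 0 comes from a root, because w/u has norm 1 and hence equals a^(q−1) by Hilbert 90.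
-- Such a w exists iff ℓ(u) ∈ F_q and D = ℓ(u)² − N(u) is not a nonzero square in F_q. Indeed (w + ℓ(u))² = D,
-- so a square root of D in F_q would put w in F_q and force D = 0; otherwise D has a square root s in F_{q²}
-- with s^q = −s, and w = s − ℓ(u) (or w = −ℓ(u) when D = 0) will do.

open import Defs
open import Level using (Level; _⊔_)
open import Data.Nat as ℕ using (ℕ; zero; suc; _≤_; _<_; z≤n; s≤s; _!)
  renaming (_+_ to _+ℕ_; _*_ to _*ℕ_; _^_ to _^ℕ_)
import Data.Nat.Properties as ℕP
open import Data.Nat.Tactic.RingSolver using (solve-∀)
open import Data.Nat.Combinatorics using (_C_; nCk≡n!/k![n-k]!; k![n∸k]!∣n!; nCn≡1)
open import Data.Nat.DivMod using (m/n*n≡m)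
open import Data.Nat.Divisibility using (_∣_; divides; ∣⇒≤; ∣1⇒≡1; m∣m*n)
open import Data.Nat.Primality using (Prime; prime⇒nonTrivial; prime⇒nonZero; prime⇒irreducible; euclidsLemma)
open import Data.Integer as ℤ using (ℤ; +_; -[1+_]; _⊖_; sign; ∣_∣; _◃_)
import Data.Integer.Properties as ℤP
open import Data.Sign as Sign using (Sign)
open import Data.Maybe using (Maybe; just; nothing)
open import Data.Product using (∃; ∃₂; ∃-syntax; _×_; _,_; proj₁; proj₂)
open import Data.Sum using (_⊎_; inj₁; inj₂; [_,_]′)
open import Data.Empty using (⊥; ⊥-elim)
open import Function using (_∘_)
open import Data.Fin as Fin using (Fin)
import Data.Fin.Properties as FinP
open import Data.List using (List; []; _∷_; length; replicate; tabulate; filter)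
open import Data.List.Properties using (length-replicate; length-tabulate; length-filter; filter-all)
open import Data.List.Relation.Unary.All as All using (All; []; _∷_)
import Data.List.Relation.Unary.All.Properties as AllP
open import Data.List.Relation.Unary.AllPairs using (AllPairs; []; _∷_)
import Data.List.Relation.Unary.AllPairs.Properties as AllPairsP
open import Data.Fin.Permutation using (permutation)
open import Relation.Binary.PropositionalEquality as ≡ using (_≡_; _≢_)
open import Relation.Nullary using (¬_; ¬?; Dec; yes; no; contradiction; _×-dec_)
open import Relation.Nullary.Decidable using (decidable-stable)
open import Algebra.Bundles using (CommutativeRing)
open import Function.Definitions using (Congruent; Injective; Surjective)
open import Function.Bundles using (_⇔_; mk⇔)
open import Function.Construct.Composition using (_⇔-∘_)
open import Algebra.Solver.Ring.AlmostCommutativeRing using (fromCommutativeRing; _-Raw-AlmostCommutative⟶_)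
import Algebra.Solver.Ring

module IntegerCoefficientSolver {c ℓ : Level} (R : CommutativeRing c ℓ) where
  open CommutativeRing R
  open import Relation.Binary.Reasoning.Setoid setoid
  open import Algebra.Properties.Monoid.Mult +-monoid using (×-homo-+) renaming (_×_ to _·_)
  open import Algebra.Properties.Semiring.Mult semiring using (×1-homo-*)
  open import Algebra.Properties.Ring ring
    using (-‿involutive; -0#≈0#; -‿distribˡ-*; -‿distribʳ-*; -‿+-comm)

  fromℤ : ℤ → Carrier
  fromℤ (+ n) = n · 1#
  fromℤ -[1+ n ] = - (suc n · 1#)

  fromℤ-homo-neg : ∀ i → fromℤ (ℤ.- i) ≈ - fromℤ i
  fromℤ-homo-neg (+ zero) = sym -0#≈0#
  fromℤ-homo-neg (+ suc n) = refl
  fromℤ-homo-neg -[1+ n ] = sym (-‿involutive _)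

  x+y-[x+z]≈y-z : ∀ x y z → (x + y) - (x + z) ≈ y - z
  x+y-[x+z]≈y-z x y z = begin
    (x + y) - (x + z)   ≈⟨ +-congˡ (sym (-‿+-comm x z)) ⟩
    (x + y) + (- x - z) ≈⟨ +-congʳ (+-comm x y) ⟩
    (y + x) + (- x - z) ≈⟨ +-assoc y x _ ⟩
    y + (x + (- x - z)) ≈⟨ +-congˡ (sym (+-assoc x (- x) (- z))) ⟩
    y + ((x - x) - z)   ≈⟨ +-congˡ (+-congʳ (-‿inverseʳ x)) ⟩
    y + (0# - z)        ≈⟨ +-congˡ (+-identityˡ (- z)) ⟩
    y - z               ∎

  fromℤ-homo-⊖ : ∀ m n → fromℤ (m ⊖ n) ≈ m · 1# - n · 1#
  fromℤ-homo-⊖ zero zero = sym (-‿inverseʳ 0#)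
  fromℤ-homo-⊖ zero (suc n) = sym (+-identityˡ _)
  fromℤ-homo-⊖ (suc m) zero = trans (sym (+-identityʳ _)) (+-congˡ (sym -0#≈0#))
  fromℤ-homo-⊖ (suc m) (suc n) = begin
    fromℤ (suc m ⊖ suc n)          ≡⟨ ≡.cong fromℤ (ℤP.[1+m]⊖[1+n]≡m⊖n m n) ⟩
    fromℤ (m ⊖ n)                  ≈⟨ fromℤ-homo-⊖ m n ⟩
    m · 1# - n · 1#                ≈⟨ sym (x+y-[x+z]≈y-z 1# (m · 1#) (n · 1#)) ⟩
    suc m · 1# - suc n · 1#        ∎

  fromℤ-homo-+ : ∀ i j → fromℤ (i ℤ.+ j) ≈ fromℤ i + fromℤ j
  fromℤ-homo-+ -[1+ m ] -[1+ n ] = begin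
    - (suc (suc (m +ℕ n)) · 1#)     ≡⟨ ≡.cong (λ k → - (k · 1#)) (≡.sym (ℕP.+-suc (suc m) n)) ⟩
    - ((suc m +ℕ suc n) · 1#)      ≈⟨ -‿cong (×-homo-+ 1# (suc m) (suc n)) ⟩
    - (suc m · 1# + suc n · 1#)    ≈⟨ sym (-‿+-comm _ _) ⟩
    - (suc m · 1#) - (suc n · 1#)  ∎
  fromℤ-homo-+ -[1+ m ] (+ n) = trans (fromℤ-homo-⊖ n (suc m)) (+-comm _ _)
  fromℤ-homo-+ (+ m) -[1+ n ] = fromℤ-homo-⊖ m (suc n)
  fromℤ-homo-+ (+ m) (+ n) = ×-homo-+ 1# m n

  fromSign : Sign → Carrier
  fromSign Sign.+ = 1#
  fromSign Sign.- = - 1#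

  fromSign-homo-* : ∀ s t → fromSign (s Sign.* t) ≈ fromSign s * fromSign t
  fromSign-homo-* Sign.+ t = sym (*-identityˡ _)
  fromSign-homo-* Sign.- Sign.+ = sym (*-identityʳ _)
  fromSign-homo-* Sign.- Sign.- = begin
    1#              ≈⟨ sym (-‿involutive 1#) ⟩
    - - 1#          ≈⟨ -‿cong (sym (*-identityʳ _)) ⟩
    - (- 1# * 1#)   ≈⟨ -‿distribʳ-* (- 1#) 1# ⟩
    - 1# * - 1#     ∎

  fromℤ-◃ : ∀ s n → fromℤ (s ◃ n) ≈ fromSign s * (n · 1#)
  fromℤ-◃ Sign.- zero = sym (zeroʳ _)
  fromℤ-◃ Sign.+ zero = sym (zeroʳ _)
  fromℤ-◃ Sign.+ (suc n) = sym (*-identityˡ _)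
  fromℤ-◃ Sign.- (suc n) = trans (-‿cong (sym (*-identityˡ _))) (-‿distribˡ-* 1# _)

  fromℤ-sign-abs : ∀ i → fromℤ i ≈ fromSign (sign i) * (∣ i ∣ · 1#)
  fromℤ-sign-abs i = trans (reflexive (≡.cong fromℤ (≡.sym (ℤP.◃-inverse i)))) (fromℤ-◃ (sign i) ∣ i ∣)

  fromℤ-homo-* : ∀ i j → fromℤ (i ℤ.* j) ≈ fromℤ i * fromℤ j
  fromℤ-homo-* i j = begin
    fromℤ (i ℤ.* j)                                     ≈⟨ fromℤ-◃ (sign i Sign.* sign j) (∣ i ∣ *ℕ ∣ j ∣) ⟩
    fromSign (sign i Sign.* sign j) * ((∣ i ∣ *ℕ ∣ j ∣) · 1#)
      ≈⟨ *-cong (fromSign-homo-* (sign i) (sign j)) (×1-homo-* ∣ i ∣ ∣ j ∣) ⟩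
    (s * t) * (m * n)                                   ≈⟨ *-assoc s t _ ⟩
    s * (t * (m * n))                                   ≈⟨ *-congˡ (x∙yz≈y∙xz t m n) ⟩
    s * (m * (t * n))                                   ≈⟨ sym (*-assoc s m _) ⟩
    (s * m) * (t * n)                                   ≈⟨ *-cong (sym (fromℤ-sign-abs i)) (sym (fromℤ-sign-abs j)) ⟩
    fromℤ i * fromℤ j                                   ∎
    where
      s = fromSign (sign i)
      t = fromSign (sign j)
      m = ∣ i ∣ · 1#
      n = ∣ j ∣ · 1#
      open import Algebra.Properties.CommutativeSemigroup *-commutativeSemigroup using (x∙yz≈y∙xz)

  homomorphism : ℤ.+-*-rawRing -Raw-AlmostCommutative⟶ fromCommutativeRing R
  homomorphism = record
    { ⟦_⟧ = fromℤ
    ; +-homo = fromℤ-homo-+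
    ; *-homo = fromℤ-homo-*
    ; -‿homo = fromℤ-homo-neg
    ; 0-homo = refl
    ; 1-homo = +-identityʳ 1#
    }

  fromℤ-≡ : ∀ i j → Maybe (fromℤ i ≈ fromℤ j)
  fromℤ-≡ i j with i ℤP.≟ j
  ... | yes i≡j = just (reflexive (≡.cong fromℤ i≡j))
  ... | no _ = nothing

  open Algebra.Solver.Ring ℤ.+-*-rawRing (fromCommutativeRing R) homomorphism fromℤ-≡ public
    using (solve; _:=_; _:+_; _:*_; _:-_; :-_; con)

IsOdd : ℕ → Set
IsOdd n = ∃[ m ] n ≡ suc (m +ℕ m)

even-or-odd : ∀ n → ∃[ m ] (n ≡ m +ℕ m ⊎ n ≡ suc (m +ℕ m))
even-or-odd zero = 0 , inj₁ ≡.refl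
even-or-odd (suc n) with even-or-odd n
... | m , inj₁ n≡2m = m , inj₂ (≡.cong suc n≡2m)
... | m , inj₂ n≡2m+1 = suc m , inj₁ (≡.cong suc (≡.trans n≡2m+1 (≡.sym (ℕP.+-suc m m))))

odd-prime : ∀ {p} → Prime p → p ≢ 2 → IsOdd p
odd-prime {p} pr p≢2 with even-or-odd p
... | m , inj₂ p≡2m+1 = m , p≡2m+1
... | m , inj₁ p≡2m with prime⇒irreducible pr (divides m (≡.trans p≡2m (m+m≡m*2 m)))
  where
    m+m≡m*2 : ∀ m → m +ℕ m ≡ m *ℕ 2
    m+m≡m*2 = solve-∀
...   | inj₁ ()
...   | inj₂ 2≡p = ⊥-elim (p≢2 (≡.sym 2≡p))

odd-* : ∀ {m n} → IsOdd m → IsOdd n → IsOdd (m *ℕ n)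
odd-* (a , ≡.refl) (b , ≡.refl) = a *ℕ (b +ℕ b) +ℕ a +ℕ b , expand a b
  where
    expand : ∀ a b → suc (a +ℕ a) *ℕ suc (b +ℕ b)
                   ≡ suc ((a *ℕ (b +ℕ b) +ℕ a +ℕ b) +ℕ (a *ℕ (b +ℕ b) +ℕ a +ℕ b))
    expand = solve-∀

odd-^ : ∀ {m} → IsOdd m → ∀ k → IsOdd (m ^ℕ k)
odd-^ odd zero = 0 , ≡.refl
odd-^ odd (suc k) = odd-* odd (odd-^ odd k)

module _ {p : ℕ} (pr : Prime p) where

  prime>1 : 1 < p
  prime>1 = ℕ.nonTrivial⇒n>1 p {{prime⇒nonTrivial pr}}

  prime∤! : ∀ m → m < p → ¬ (p ∣ m !)
  prime∤! zero _ p∣1 = ℕP.<-irrefl (≡.sym (∣1⇒≡1 p∣1)) prime>1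
  prime∤! (suc m) m<p p∣m! with euclidsLemma (suc m) (m !) pr p∣m!
  ... | inj₁ p∣1+m = ℕP.<⇒≱ m<p (∣⇒≤ p∣1+m)
  ... | inj₂ p∣m! = prime∤! m (ℕP.<-trans (ℕP.n<1+n m) m<p) p∣m!

  prime∣choose : ∀ j → 0 < j → j < p → p ∣ p C j
  prime∣choose j 0<j j<p with euclidsLemma (p C j) (j ! *ℕ (p ℕ.∸ j) !) pr (≡.subst (p ∣_) (≡.sym p!≡) p∣p!)
    where
      j≤p = ℕP.<⇒≤ j<p
      instance _ = j ℕP.!* (p ℕ.∸ j) !≢0
      p!≡ : (p C j) *ℕ (j ! *ℕ (p ℕ.∸ j) !) ≡ p !
      p!≡ = ≡.trans (≡.cong (_*ℕ (j ! *ℕ (p ℕ.∸ j) !)) (nCk≡n!/k![n-k]! j≤p)) (m/n*n≡m (k![n∸k]!∣n! j≤p))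
      p∣p! : p ∣ p !
      p∣p! = ≡.subst (λ n → n ∣ n !) (ℕP.suc-pred p {{prime⇒nonZero pr}}) (m∣m*n _)
  ... | inj₁ p∣pCj = p∣pCj
  ... | inj₂ p∣j![p-j]! with euclidsLemma (j !) ((p ℕ.∸ j) !) pr p∣j![p-j]!
  ...   | inj₁ p∣j! = ⊥-elim (prime∤! j j<p p∣j!)
  ...   | inj₂ p∣[p-j]! = ⊥-elim (prime∤! (p ℕ.∸ j) (ℕP.∸-monoʳ-< 0<j (ℕP.<⇒≤ j<p)) p∣[p-j]!)

double-≤-cancel : ∀ {m n} → m +ℕ m ≤ n +ℕ n → m ≤ n
double-≤-cancel {m} {n} 2m≤2n = ℕP.≮⇒≥ (λ n<m → ℕP.<⇒≱ (ℕP.+-mono-< n<m n<m) 2m≤2n)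

double-nonZero : ∀ {t} → t ≢ 0 → ℕ.NonZero (t +ℕ t)
double-nonZero {zero} t≢0 = contradiction ≡.refl t≢0
double-nonZero {suc t} _ = _

Fin-injective⇒surjective : ∀ {k} (g : Fin k → Fin k) → (∀ {i j} → g i ≡ g j → i ≡ j) → ∀ j → ∃[ i ] g i ≡ j
Fin-injective⇒surjective g g-injective j with FinP.any? (λ i → g i Fin.≟ j)
... | yes hit = hit
Fin-injective⇒surjective {suc k} g g-injective j | no miss =
  ⊥-elim (collision (FinP.pigeonhole (ℕP.n<1+n k) (λ i → Fin.punchOut (j≢g i))))
  where
    j≢g : ∀ i → j ≢ g i
    j≢g i j≡gi = miss (i , ≡.sym j≡gi)
    collision : ∃₂ (λ i i′ → i Fin.< i′ × Fin.punchOut (j≢g i) ≡ Fin.punchOut (j≢g i′)) → ⊥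
    collision (i , i′ , i<i′ , eq) =
      ℕP.<-irrefl (≡.cong Fin.toℕ (g-injective (FinP.punchOut-injective (j≢g i) (j≢g i′) eq))) i<i′

module _ {c ℓ : Level} (R : CommutativeRing c ℓ) where
  open CommutativeRing R
  open FieldTheory R
  open IntegerCoefficientSolver R using (solve; _:=_; _:+_; _:*_; _:-_; :-_; con)
  open import Relation.Binary.Reasoning.Setoid setoid
  open import Algebra.Properties.Ring ring
    using (x+x≈x⇒x≈0; +-inverseˡ-unique; +-inverseʳ-unique; +-cancelʳ; x∙y⁻¹≈ε⇒x≈y; x≈y⇒x∙y⁻¹≈ε; -‿involutive; -1*x≈-x; -‿+-comm)
  open import Algebra.Properties.Monoid.Mult +-monoid using (×-homo-+; ×-congʳ; ×-assocˡ)
    renaming (_×_ to _·_)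
  open import Algebra.Properties.Semiring.Mult semiring using (×-assoc-*)
  open import Algebra.Properties.Semiring.Exp semiring using (^-congˡ; ^-homo-*; ^-assocʳ)
  open import Algebra.Properties.CommutativeSemiring.Exp commutativeSemiring using (^-distrib-*)
  open import Algebra.Properties.CommutativeSemiring.Binomial commutativeSemiring
    using (binomialTerm) renaming (theorem to binomial-theorem)
  open import Algebra.Definitions.RawMonoid +-rawMonoid using () renaming (sum to ∑)
  open import Algebra.Definitions.RawMonoid *-rawMonoid using () renaming (sum to ∏)
  open import Algebra.Properties.Monoid.Sum *-monoid using () renaming (sum-cong-≋ to ∏-cong)
  open import Algebra.Properties.CommutativeMonoid.Sum *-commutativeMonoid using () renaming (sum-permute to ∏-permute)

  record IsAdditive (φ : Carrier → Carrier) : Set (c ⊔ ℓ) where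
    field
      cong : ∀ {x y} → x ≈ y → φ x ≈ φ y
      homo : ∀ x y → φ (x + y) ≈ φ x + φ y

    0-homo : φ 0# ≈ 0#
    0-homo = x+x≈x⇒x≈0 (φ 0#) (trans (sym (homo 0# 0#)) (cong (+-identityʳ 0#)))

    -‿homo : ∀ x → φ (- x) ≈ - φ x
    -‿homo x = +-inverseʳ-unique (φ x) (φ (- x))
      (trans (sym (homo x (- x))) (trans (cong (-‿inverseʳ x)) 0-homo))

    sub-homo : ∀ x y → φ (x - y) ≈ φ x - φ y
    sub-homo x y = trans (homo x (- y)) (+-congˡ (-‿homo y))

  1#^ : ∀ n → 1# ^ n ≈ 1#
  1#^ zero = refl
  1#^ (suc n) = trans (*-identityˡ _) (1#^ n)

  ^-+1 : ∀ x n → x ^ (n +ℕ 1) ≈ x ^ n * x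
  ^-+1 x n = trans (^-homo-* x n 1) (*-congˡ (*-identityʳ x))

  x^2≈x*x : ∀ x → x ^ 2 ≈ x * x
  x^2≈x*x x = *-congˡ (*-identityʳ x)

  sum-of-last : ∀ m (g : Fin (suc m) → Carrier) → (∀ i → g (Fin.inject₁ i) ≈ 0#) → ∑ g ≈ g (Fin.fromℕ m)
  sum-of-last zero g _ = +-identityʳ _
  sum-of-last (suc m) g g≈0 =
    trans (+-congʳ (g≈0 Fin.zero)) (trans (+-identityˡ _) (sum-of-last m (g ∘ Fin.suc) (g≈0 ∘ Fin.suc)))

  freshmans-dream : ∀ n .{{_ : ℕ.NonZero n}} → (∀ j → 0 < j → j < n → ∀ z → (n C j) · z ≈ 0#) →
                    ∀ x y → (x + y) ^ n ≈ x ^ n + y ^ n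
  freshmans-dream (suc m) interior≈0 x y = begin
    (x + y) ^ suc m                           ≈⟨ binomial-theorem (suc m) x y ⟩
    term Fin.zero + ∑ (term ∘ Fin.suc)        ≈⟨ +-congˡ (sum-of-last m (term ∘ Fin.suc) middle≈0) ⟩
    term Fin.zero + term (Fin.fromℕ (suc m))  ≈⟨ +-comm _ _ ⟩
    term (Fin.fromℕ (suc m)) + term Fin.zero  ≈⟨ +-cong last≈ first≈ ⟩
    x ^ suc m + y ^ suc m                     ∎
    where
      term = binomialTerm x y (suc m)
      middle≈0 : ∀ (i : Fin m) → term (Fin.suc (Fin.inject₁ i)) ≈ 0#
      middle≈0 i = interior≈0 (suc (Fin.toℕ (Fin.inject₁ i))) (s≤s z≤n)
        (s≤s (≡.subst (_< m) (≡.sym (FinP.toℕ-inject₁ i)) (FinP.toℕ<n i))) _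
      first≈ : term Fin.zero ≈ y ^ suc m
      first≈ = trans (+-identityʳ _) (*-identityˡ _)
      last≈ : term (Fin.fromℕ (suc m)) ≈ x ^ suc m
      last≈ rewrite FinP.toℕ-fromℕ m | nCn≡1 (suc m) | ℕP.n∸n≡0 m = trans (+-identityʳ _) (*-identityʳ _)

  module Characteristic {p : ℕ} (pr : Prime p) (char : CharDivides p) where

    multiple-of-char : ∀ {m} → p ∣ m → ∀ x → m · x ≈ 0#
    multiple-of-char {m} (divides j m≡j*p) x = begin
      m · x               ≡⟨ ≡.cong (_· x) m≡j*p ⟩
      (j *ℕ p) · x        ≈⟨ sym (×-assocˡ x j p) ⟩
      j · (p · x)         ≈⟨ ×-congʳ j p·x≈0 ⟩
      j · 0#              ≈⟨ j·0≈0 j ⟩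
      0#                  ∎
      where
        p·x≈0 : p · x ≈ 0#
        p·x≈0 = begin
          p · x           ≈⟨ ×-congʳ p (sym (*-identityˡ x)) ⟩
          p · (1# * x)    ≈⟨ sym (×-assoc-* p 1# x) ⟩
          (p · 1#) * x    ≈⟨ *-congʳ char ⟩
          0# * x          ≈⟨ zeroˡ x ⟩
          0#              ∎
        j·0≈0 : ∀ j → j · 0# ≈ 0#
        j·0≈0 zero = refl
        j·0≈0 (suc j) = trans (+-identityˡ _) (j·0≈0 j)

    odd⇒2≉0 : 1# ≉ 0# → IsOdd p → 1# + 1# ≉ 0#
    odd⇒2≉0 1≉0 (m , p≡2m+1) 2≈0 = 1≉0 (begin
      1#                          ≈⟨ sym (+-identityʳ 1#) ⟩
      1# + 0#                     ≈⟨ +-congˡ (sym 2m·1≈0) ⟩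
      1# + (m +ℕ m) · 1#          ≡⟨ ≡.cong (_· 1#) (≡.sym p≡2m+1) ⟩
      p · 1#                      ≈⟨ char ⟩
      0#                          ∎)
      where
        2m·1≈0 : (m +ℕ m) · 1# ≈ 0#
        2m·1≈0 = begin
          (m +ℕ m) · 1#           ≈⟨ ×-homo-+ 1# m m ⟩
          m · 1# + m · 1#         ≈⟨ sym (+-cong (*-identityʳ _) (*-identityʳ _)) ⟩
          (m · 1#) * 1# + (m · 1#) * 1# ≈⟨ sym (distribˡ _ 1# 1#) ⟩
          (m · 1#) * (1# + 1#)    ≈⟨ *-congˡ 2≈0 ⟩
          (m · 1#) * 0#           ≈⟨ zeroʳ _ ⟩
          0#                      ∎

    frobenius : ∀ x y → (x + y) ^ p ≈ x ^ p + y ^ p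
    frobenius = freshmans-dream p {{prime⇒nonZero pr}} (λ j 0<j j<p → multiple-of-char (prime∣choose pr j 0<j j<p))

    frobenius^ : ∀ i x y → (x + y) ^ (p ^ℕ i) ≈ x ^ (p ^ℕ i) + y ^ (p ^ℕ i)
    frobenius^ zero x y = trans (*-identityʳ _) (+-cong (sym (*-identityʳ x)) (sym (*-identityʳ y)))
    frobenius^ (suc i) x y = begin
      (x + y) ^ (p *ℕ m)            ≈⟨ sym (^-assocʳ (x + y) p m) ⟩
      ((x + y) ^ p) ^ m             ≈⟨ ^-congˡ m (frobenius x y) ⟩
      (x ^ p + y ^ p) ^ m           ≈⟨ frobenius^ i (x ^ p) (y ^ p) ⟩
      (x ^ p) ^ m + (y ^ p) ^ m     ≈⟨ +-cong (^-assocʳ x p m) (^-assocʳ y p m) ⟩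
      x ^ (p *ℕ m) + y ^ (p *ℕ m)   ∎
      where m = p ^ℕ i

    ^p^-additive : ∀ i → IsAdditive (_^ (p ^ℕ i))
    ^p^-additive i = record { cong = ^-congˡ (p ^ℕ i) ; homo = frobenius^ i }

    linEvalFrom-additive : ∀ i bs → IsAdditive (linEvalFrom p i bs)
    linEvalFrom-additive i [] = record { cong = λ _ → refl ; homo = λ _ _ → sym (+-identityʳ 0#) }
    linEvalFrom-additive i (b ∷ bs) = record
      { cong = λ x≈y → +-cong (*-congˡ (^-congˡ (p ^ℕ i) x≈y)) (L.cong x≈y)
      ; homo = λ x y → begin
          b * (x + y) ^ m + rest (x + y)            ≈⟨ +-cong (*-congˡ (frobenius^ i x y)) (L.homo x y) ⟩
          b * (x ^ m + y ^ m) + (rest x + rest y)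
            ≈⟨ solve 5 (λ b X Y u v → b :* (X :+ Y) :+ (u :+ v) := (b :* X :+ u) :+ (b :* Y :+ v))
                 refl b (x ^ m) (y ^ m) (rest x) (rest y) ⟩
          (b * x ^ m + rest x) + (b * y ^ m + rest y) ∎
      }
      where
        m = p ^ℕ i
        rest = linEvalFrom p (suc i) bs
        module L = IsAdditive (linEvalFrom-additive (suc i) bs)

    linEval-additive : ∀ bs → IsAdditive (linEval p bs)
    linEval-additive = linEvalFrom-additive 0

  module Field (isField : IsField) where

    1≉0 : 1# ≉ 0#
    1≉0 = proj₁ isField

    inverse : ∀ x → x ≉ 0# → Carrier
    inverse x x≉0 = proj₁ (proj₂ isField x x≉0)

    *-inverseʳ : ∀ x (x≉0 : x ≉ 0#) → x * inverse x x≉0 ≈ 1#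
    *-inverseʳ x x≉0 = proj₂ (proj₂ isField x x≉0)

    x≉0∧x*y≈0⇒y≈0 : ∀ {x y} → x ≉ 0# → x * y ≈ 0# → y ≈ 0#
    x≉0∧x*y≈0⇒y≈0 {x} {y} x≉0 x*y≈0 = begin
      y                     ≈⟨ sym (*-identityˡ y) ⟩
      1# * y                ≈⟨ *-congʳ (sym (*-inverseʳ x x≉0)) ⟩
      (x * x⁻¹) * y         ≈⟨ solve 3 (λ x i y → (x :* i) :* y := i :* (x :* y)) refl x x⁻¹ y ⟩
      x⁻¹ * (x * y)         ≈⟨ *-congˡ x*y≈0 ⟩
      x⁻¹ * 0#              ≈⟨ zeroʳ x⁻¹ ⟩
      0#                    ∎
      where x⁻¹ = inverse x x≉0

    *-≉0 : ∀ {x y} → x ≉ 0# → y ≉ 0# → x * y ≉ 0#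
    *-≉0 x≉0 y≉0 x*y≈0 = y≉0 (x≉0∧x*y≈0⇒y≈0 x≉0 x*y≈0)

    inverse-≉0 : ∀ x (x≉0 : x ≉ 0#) → inverse x x≉0 ≉ 0#
    inverse-≉0 x x≉0 x⁻¹≈0 = 1≉0 (trans (sym (*-inverseʳ x x≉0)) (trans (*-congˡ x⁻¹≈0) (zeroʳ x)))

    *-cancelˡ : ∀ {x y z} → x ≉ 0# → x * y ≈ x * z → y ≈ z
    *-cancelˡ {x} {y} {z} x≉0 xy≈xz = x∙y⁻¹≈ε⇒x≈y y z (x≉0∧x*y≈0⇒y≈0 x≉0 (begin
      x * (y - z)           ≈⟨ solve 3 (λ x y z → x :* (y :- z) := x :* y :- x :* z) refl x y z ⟩
      x * y - x * z         ≈⟨ x≈y⇒x∙y⁻¹≈ε xy≈xz ⟩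
      0#                    ∎))

    double-injective : 1# + 1# ≉ 0# → ∀ {x y} → x + x ≈ y + y → x ≈ y
    double-injective 2≉0 {x} {y} 2x≈2y = x∙y⁻¹≈ε⇒x≈y x y (x≉0∧x*y≈0⇒y≈0 2≉0 (begin
      (1# + 1#) * (x - y)   ≈⟨ distribʳ (x - y) 1# 1# ⟩
      1# * (x - y) + 1# * (x - y) ≈⟨ +-cong (*-identityˡ _) (*-identityˡ _) ⟩
      (x - y) + (x - y)     ≈⟨ solve 2 (λ x y → (x :- y) :+ (x :- y) := (x :+ x) :- (y :+ y)) refl x y ⟩
      (x + x) - (y + y)     ≈⟨ x≈y⇒x∙y⁻¹≈ε 2x≈2y ⟩
      0#                    ∎))

    Distinct : List Carrier → Set (c ⊔ ℓ)
    Distinct = AllPairs _≉_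

    -- The list a₀ ∷ a₁ ∷ … ∷ a_{d-1} stands for the monic polynomial a₀ + a₁ X + … + a_{d-1} X^{d-1} + X^d.
    evalMonic : List Carrier → Carrier → Carrier
    evalMonic [] x = 1#
    evalMonic (a ∷ as) x = a + x * evalMonic as x

    divideByRoot : Carrier → List Carrier → List Carrier
    divideByRoot r [] = []
    divideByRoot r (a ∷ []) = []
    divideByRoot r (a ∷ b ∷ bs) = evalMonic (b ∷ bs) r ∷ divideByRoot r (b ∷ bs)

    length-divideByRoot : ∀ r a as → length (divideByRoot r (a ∷ as)) ≡ length as
    length-divideByRoot r a [] = ≡.refl
    length-divideByRoot r a (b ∷ bs) = ≡.cong suc (length-divideByRoot r b bs)

    evalMonic-divideByRoot : ∀ r a as x →
      evalMonic (a ∷ as) x ≈ (x - r) * evalMonic (divideByRoot r (a ∷ as)) x + evalMonic (a ∷ as) r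
    evalMonic-divideByRoot r a [] x = solve 4 (λ r a x o → a :+ x :* o := (x :- r) :* o :+ (a :+ r :* o)) refl r a x 1#
    evalMonic-divideByRoot r a (b ∷ bs) x = begin
      a + x * Q x                           ≈⟨ +-congˡ (*-congˡ (evalMonic-divideByRoot r b bs x)) ⟩
      a + x * ((x - r) * Q′ x + Q r)
        ≈⟨ solve 5 (λ a x r q′ qr → a :+ x :* ((x :- r) :* q′ :+ qr) := (x :- r) :* (qr :+ x :* q′) :+ (a :+ r :* qr))
             refl a x r (Q′ x) (Q r) ⟩
      (x - r) * (Q r + x * Q′ x) + (a + r * Q r) ∎
      where
        Q = evalMonic (b ∷ bs)
        Q′ = evalMonic (divideByRoot r (b ∷ bs))

    roots≤degree : ∀ as rs → Distinct rs → All (λ r → evalMonic as r ≈ 0#) rs → length rs ≤ length as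
    roots≤degree as [] _ _ = z≤n
    roots≤degree [] (r ∷ rs) _ (1≈0 ∷ _) = ⊥-elim (1≉0 1≈0)
    roots≤degree (a ∷ as) (r ∷ rs) (r≉rs ∷ distinct) (root ∷ roots) =
      ≡.subst (λ d → suc (length rs) ≤ suc d) (length-divideByRoot r a as)
        (s≤s (roots≤degree (divideByRoot r (a ∷ as)) rs distinct (quotient-roots rs r≉rs roots)))
      where
        quotient-roots : ∀ ys → All (r ≉_) ys → All (λ y → evalMonic (a ∷ as) y ≈ 0#) ys →
                         All (λ y → evalMonic (divideByRoot r (a ∷ as)) y ≈ 0#) ys
        quotient-roots [] _ _ = []
        quotient-roots (y ∷ ys) (r≉y ∷ r≉ys) (y-root ∷ ys-roots) =
          x≉0∧x*y≈0⇒y≈0 (λ y-r≈0 → r≉y (sym (x∙y⁻¹≈ε⇒x≈y y r y-r≈0))) (begin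
            (y - r) * Q y               ≈⟨ sym (+-identityʳ _) ⟩
            (y - r) * Q y + 0#          ≈⟨ +-congˡ (sym root) ⟩
            (y - r) * Q y + P r         ≈⟨ sym (evalMonic-divideByRoot r a as y) ⟩
            P y                         ≈⟨ y-root ⟩
            0#                          ∎) ∷ quotient-roots ys r≉ys ys-roots
          where
            P = evalMonic (a ∷ as)
            Q = evalMonic (divideByRoot r (a ∷ as))

    roots-of-power≤ : ∀ d b rs → Distinct rs → All (λ r → r ^ suc d ≈ b) rs → length rs ≤ suc d
    roots-of-power≤ d b rs distinct roots =
      ≡.subst (length rs ≤_) (≡.cong suc (length-replicate d))
        (roots≤degree (- b ∷ replicate d 0#) rs distinct (All.map root⇒zero roots))
      where
        evalMonic-zeros : ∀ j x → evalMonic (replicate j 0#) x ≈ x ^ j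
        evalMonic-zeros zero x = refl
        evalMonic-zeros (suc j) x = trans (+-identityˡ _) (*-congˡ (evalMonic-zeros j x))
        root⇒zero : ∀ {y} → y ^ suc d ≈ b → evalMonic (- b ∷ replicate d 0#) y ≈ 0#
        root⇒zero {y} y^d+1≈b = begin
          - b + y * evalMonic (replicate d 0#) y  ≈⟨ +-congˡ (*-congˡ (evalMonic-zeros d y)) ⟩
          - b + y ^ suc d                         ≈⟨ +-congˡ y^d+1≈b ⟩
          - b + b                                 ≈⟨ -‿inverseˡ b ⟩
          0#                                      ∎

  module FiniteField (isField : IsField) {m : ℕ} (order : HasOrder (suc m)) where
    open Field isField

    enum : Fin (suc m) → Carrier
    enum = proj₁ order

    enum-injective : ∀ {i j} → enum i ≈ enum j → i ≡ j
    enum-injective = proj₁ (proj₂ order)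

    index : Carrier → Fin (suc m)
    index x = proj₁ (proj₂ (proj₂ order) x)

    enum-index : ∀ x → enum (index x) ≈ x
    enum-index x = proj₂ (proj₂ (proj₂ order) x) ≡.refl

    index-injective : ∀ {x y} → index x ≡ index y → x ≈ y
    index-injective {x} {y} eq = trans (sym (enum-index x)) (trans (reflexive (≡.cong enum eq)) (enum-index y))

    index-cong : ∀ {x y} → x ≈ y → index x ≡ index y
    index-cong {x} {y} x≈y = enum-injective (trans (enum-index x) (trans x≈y (sym (enum-index y))))

    infix 4 _≟_
    _≟_ : ∀ x y → Dec (x ≈ y)
    x ≟ y with index x Fin.≟ index y
    ... | yes eq = yes (index-injective eq)
    ... | no neq = no (neq ∘ index-cong)

    any? : ∀ {a} {P : Carrier → Set a} → (∀ x → Dec (P x)) → (∀ {x y} → x ≈ y → P x → P y) → Dec (∃ P)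
    any? P? resp with FinP.any? (P? ∘ enum)
    ... | yes (i , Pi) = yes (enum i , Pi)
    ... | no none = no λ (x , Px) → none (index x , resp (sym (enum-index x)) Px)

    zero-product : ∀ {x y} → x * y ≈ 0# → x ≈ 0# ⊎ y ≈ 0#
    zero-product {x} x*y≈0 with x ≟ 0#
    ... | yes x≈0 = inj₁ x≈0
    ... | no x≉0 = inj₂ (x≉0∧x*y≈0⇒y≈0 x≉0 x*y≈0)

    x²≈y²⇒x≈±y : ∀ {x y} → x * x ≈ y * y → x ≈ y ⊎ x ≈ - y
    x²≈y²⇒x≈±y {x} {y} x²≈y² with zero-product {x - y} {x + y} (begin
        (x - y) * (x + y)   ≈⟨ solve 2 (λ x y → (x :- y) :* (x :+ y) := x :* x :- y :* y) refl x y ⟩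
        x * x - y * y       ≈⟨ x≈y⇒x∙y⁻¹≈ε x²≈y² ⟩
        0#                  ∎)
    ... | inj₁ x-y≈0 = inj₁ (x∙y⁻¹≈ε⇒x≈y x y x-y≈0)
    ... | inj₂ x+y≈0 = inj₂ (x∙y⁻¹≈ε⇒x≈y x (- y) (trans (+-congˡ (-‿involutive y)) x+y≈0))

    injective⇒surjective : ∀ (φ : Carrier → Carrier) → Congruent _≈_ _≈_ φ → Injective _≈_ _≈_ φ →
                           Surjective _≈_ _≈_ φ
    injective⇒surjective φ φ-cong φ-injective y
      with i , φi≡y ← Fin-injective⇒surjective (index ∘ φ ∘ enum)
                         (enum-injective ∘ φ-injective ∘ index-injective) (index y)
      = enum i , λ z≈ei → trans (φ-cong z≈ei) (index-injective φi≡y)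

    nonzero : Fin m → Carrier
    nonzero j = enum (Fin.punchIn (index 0#) j)

    nonzero-≉0 : ∀ j → nonzero j ≉ 0#
    nonzero-≉0 j nj≈0 = FinP.punchInᵢ≢i (index 0#) j (enum-injective (trans nj≈0 (sym (enum-index 0#))))

    nonzero-injective : ∀ {i j} → nonzero i ≈ nonzero j → i ≡ j
    nonzero-injective = FinP.punchIn-injective (index 0#) _ _ ∘ enum-injective

    nonzero⁻¹ : ∀ x → x ≉ 0# → Fin m
    nonzero⁻¹ x x≉0 = Fin.punchOut {i = index 0#} {j = index x} (x≉0 ∘ index-injective ∘ ≡.sym)

    nonzero-nonzero⁻¹ : ∀ x (x≉0 : x ≉ 0#) → nonzero (nonzero⁻¹ x x≉0) ≈ x
    nonzero-nonzero⁻¹ x x≉0 = trans (reflexive (≡.cong enum (FinP.punchIn-punchOut _))) (enum-index x)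

    scale : ∀ b → b ≉ 0# → Fin m → Fin m
    scale b b≉0 j = nonzero⁻¹ (b * nonzero j) (*-≉0 b≉0 (nonzero-≉0 j))

    nonzero-scale : ∀ b (b≉0 : b ≉ 0#) j → nonzero (scale b b≉0 j) ≈ b * nonzero j
    nonzero-scale b b≉0 j = nonzero-nonzero⁻¹ (b * nonzero j) (*-≉0 b≉0 (nonzero-≉0 j))

    scale-scale : ∀ b c (b≉0 : b ≉ 0#) (c≉0 : c ≉ 0#) → b * c ≈ 1# → ∀ j → scale b b≉0 (scale c c≉0 j) ≡ j
    scale-scale b c b≉0 c≉0 bc≈1 j = nonzero-injective (begin
      nonzero (scale b b≉0 (scale c c≉0 j)) ≈⟨ nonzero-scale b b≉0 _ ⟩
      b * nonzero (scale c c≉0 j)           ≈⟨ *-congˡ (nonzero-scale c c≉0 j) ⟩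
      b * (c * nonzero j)                   ≈⟨ sym (*-assoc b c _) ⟩
      (b * c) * nonzero j                   ≈⟨ *-congʳ bc≈1 ⟩
      1# * nonzero j                        ≈⟨ *-identityˡ _ ⟩
      nonzero j                             ∎)

    ∏-scale : ∀ {k} a (g : Fin k → Carrier) → ∏ (λ i → a * g i) ≈ a ^ k * ∏ g
    ∏-scale {zero} a g = sym (*-identityˡ _)
    ∏-scale {suc k} a g = begin
      (a * g Fin.zero) * ∏ (λ i → a * g (Fin.suc i))   ≈⟨ *-congˡ (∏-scale a (g ∘ Fin.suc)) ⟩
      (a * g Fin.zero) * (a ^ k * ∏ (g ∘ Fin.suc))
        ≈⟨ solve 4 (λ a b c d → (a :* b) :* (c :* d) := (a :* c) :* (b :* d)) refl a (g Fin.zero) (a ^ k) _ ⟩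
      (a * a ^ k) * (g Fin.zero * ∏ (g ∘ Fin.suc))     ∎

    ∏-≉0 : ∀ {k} (g : Fin k → Carrier) → (∀ i → g i ≉ 0#) → ∏ g ≉ 0#
    ∏-≉0 {zero} g _ = 1≉0
    ∏-≉0 {suc k} g g≉0 = *-≉0 (g≉0 Fin.zero) (∏-≉0 (g ∘ Fin.suc) (g≉0 ∘ Fin.suc))

    -- Multiplication by a permutes the nonzero elements, so it leaves their product unchanged.
    fermat : ∀ a → a ≉ 0# → a ^ m ≈ 1#
    fermat a a≉0 = *-cancelˡ (∏-≉0 nonzero nonzero-≉0) (begin
      P * a ^ m                            ≈⟨ *-comm P _ ⟩
      a ^ m * P                            ≈⟨ sym (∏-scale a nonzero) ⟩
      ∏ (λ j → a * nonzero j)              ≈⟨ ∏-cong (λ j → sym (nonzero-scale a a≉0 j)) ⟩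
      ∏ (nonzero ∘ scale a a≉0)            ≈⟨ sym (∏-permute nonzero π) ⟩
      P                                    ≈⟨ sym (*-identityʳ P) ⟩
      P * 1#                               ∎)
      where
        P = ∏ nonzero
        a⁻¹ = inverse a a≉0
        a⁻¹≉0 = inverse-≉0 a a≉0
        π = permutation (scale a a≉0) (scale a⁻¹ a⁻¹≉0)
              (scale-scale a a⁻¹ a≉0 a⁻¹≉0 (*-inverseʳ a a≉0))
              (scale-scale a⁻¹ a a⁻¹≉0 a≉0 (trans (*-comm a⁻¹ a) (*-inverseʳ a a≉0)))

    fermat-^suc : ∀ a → a ^ suc m ≈ a
    fermat-^suc a with a ≟ 0#
    ... | yes a≈0 = trans (*-congʳ a≈0) (trans (zeroˡ _) (sym a≈0))
    ... | no a≉0 = trans (*-congˡ (fermat a a≉0)) (*-identityʳ a)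

    nonzeros : List Carrier
    nonzeros = tabulate nonzero

    length-nonzeros : length nonzeros ≡ m
    length-nonzeros = length-tabulate nonzero

    nonzeros-distinct : Distinct nonzeros
    nonzeros-distinct = AllPairsP.tabulate⁺ (λ i≢j → i≢j ∘ nonzero-injective)

    nonzeros-≉0 : All (_≉ 0#) nonzeros
    nonzeros-≉0 = AllP.tabulate⁺ nonzero-≉0

    all-roots⇒order≤ : ∀ d .{{_ : ℕ.NonZero d}} → (∀ x → x ≉ 0# → x ^ d ≈ 1#) → m ≤ d
    all-roots⇒order≤ (suc d) all-roots = ≡.subst (_≤ suc d) length-nonzeros
      (roots-of-power≤ d 1# nonzeros nonzeros-distinct (All.map (all-roots _) nonzeros-≉0))

    remove : Carrier → List Carrier → List Carrier
    remove w = filter (λ y → ¬? (y ≟ w))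

    length-remove : ∀ w ys → Distinct ys → length ys ≤ suc (length (remove w ys))
    length-remove w [] _ = z≤n
    length-remove w (y ∷ ys) (y≉ys ∷ distinct) with y ≟ w
    ... | yes y≈w = s≤s (ℕP.≤-reflexive (≡.sym (≡.cong length
                      (filter-all (λ y → ¬? (y ≟ w)) (All.map (λ y≉z z≈w → y≉z (trans y≈w (sym z≈w))) y≉ys)))))
    ... | no _ = s≤s (length-remove w ys distinct)

    -- Dropping −x lists each square once; the fuel k only ensures termination.
    squares : ℕ → List Carrier → List Carrier
    squares zero _ = []
    squares (suc k) [] = []
    squares (suc k) (x ∷ xs) = x * x ∷ squares k (remove (- x) xs)

    squares-all : ∀ {a} (P : Carrier → Set a) k xs → All (λ y → P (y * y)) xs → All P (squares k xs)
    squares-all P zero xs _ = []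
    squares-all P (suc k) [] _ = []
    squares-all P (suc k) (x ∷ xs) (Px² ∷ Pxs²) = Px² ∷ squares-all P k _ (AllP.filter⁺ _ Pxs²)

    squares-distinct : ∀ k xs → Distinct xs → Distinct (squares k xs)
    squares-distinct zero xs _ = []
    squares-distinct (suc k) [] _ = []
    squares-distinct (suc k) (x ∷ xs) (x≉xs ∷ distinct) =
      squares-all (x * x ≉_) k _ (All.zipWith x²≉y² (AllP.filter⁺ _ x≉xs , AllP.all-filter _ xs))
        ∷ squares-distinct k _ (AllPairsP.filter⁺ _ distinct)
      where
        x²≉y² : ∀ {y} → x ≉ y × ¬ (y ≈ - x) → x * x ≉ y * y
        x²≉y² (x≉y , y≉-x) x²≈y² = [ x≉y , (λ x≈-y → y≉-x (trans (sym (-‿involutive _)) (-‿cong (sym x≈-y)))) ]′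
          (x²≈y²⇒x≈±y x²≈y²)

    length-squares : ∀ k xs → length xs ≤ k → Distinct xs → length xs ≤ length (squares k xs) +ℕ length (squares k xs)
    length-squares zero [] _ _ = z≤n
    length-squares (suc k) [] _ _ = z≤n
    length-squares (suc k) (x ∷ xs) (s≤s |xs|≤k) (_ ∷ distinct) =
      s≤s (ℕP.≤-trans (length-remove (- x) xs distinct) (≡.subst (suc (length xs′) ≤_) (≡.sym (ℕP.+-suc |S| |S|))
        (s≤s (length-squares k xs′ (ℕP.≤-trans (length-filter _ xs) |xs|≤k) (AllPairsP.filter⁺ _ distinct)))))
      where
        xs′ = remove (- x) xs
        |S| = length (squares k xs′)

    -- Euler's criterion, in the direction needed: the m/2 nonzero squares already exhaust the roots of X^(m/2) - 1.
    euler-criterion : ∀ h .{{_ : ℕ.NonZero h}} → m ≡ h +ℕ h → ∀ a → a ^ h ≈ 1# → ∃[ s ] s * s ≈ a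
    euler-criterion (suc h) m≡2h a a^h≈1 with any? (λ s → s * s ≟ a) (λ s≈t s²≈a → trans (*-cong (sym s≈t) (sym s≈t)) s²≈a)
    ... | yes square = square
    ... | no nonsquare = ⊥-elim (ℕP.<⇒≱ (s≤s h<|S|) (roots-of-power≤ h 1# (a ∷ S) (a≉S ∷ S-distinct) (a^h≈1 ∷ S-roots)))
      where
        S = squares m nonzeros
        S-distinct = squares-distinct m nonzeros nonzeros-distinct
        S-roots : All (λ s → s ^ suc h ≈ 1#) S
        S-roots = squares-all _ m nonzeros (All.map (λ {x} x≉0 → begin
          (x * x) ^ suc h           ≈⟨ ^-distrib-* x x (suc h) ⟩
          x ^ suc h * x ^ suc h     ≈⟨ sym (^-homo-* x (suc h) (suc h)) ⟩
          x ^ (suc h +ℕ suc h)      ≡⟨ ≡.cong (x ^_) (≡.sym m≡2h) ⟩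
          x ^ m                     ≈⟨ fermat x x≉0 ⟩
          1#                        ∎) nonzeros-≉0)
        a≉S : All (a ≉_) S
        a≉S = squares-all (a ≉_) m nonzeros (AllP.tabulate⁺ (λ j a≈x² → nonsquare (nonzero j , sym a≈x²)))
        h<|S| : h < length S
        h<|S| = double-≤-cancel (≡.subst (_≤ length S +ℕ length S) (≡.trans length-nonzeros m≡2h)
                  (length-squares m nonzeros (ℕP.≤-reflexive length-nonzeros) nonzeros-distinct))

  module QuadraticExtension {p : ℕ} (pr : Prime p) (p≢2 : p ≢ 2) (k : ℕ) (1≤k : 1 ≤ k) (isField : IsField)
                            (order : HasOrder (p ^ℕ k *ℕ p ^ℕ k)) (char : CharDivides p) where
    open Field isField
    open Characteristic pr char

    q : ℕ
    q = p ^ℕ k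

    q-odd : IsOdd q
    q-odd = odd-^ (odd-prime pr p≢2) k

    t : ℕ
    t = proj₁ q-odd

    q≡2t+1 : q ≡ suc (t +ℕ t)
    q≡2t+1 = proj₂ q-odd

    t≢0 : t ≢ 0
    t≢0 t≡0 = ℕP.<⇒≢ (ℕP.^-monoʳ-< p (prime>1 pr) 1≤k) (≡.sym (≡.trans q≡2t+1 (≡.cong (λ t → suc (t +ℕ t)) t≡0)))

    instance
      2t-nonZero : ℕ.NonZero (t +ℕ t)
      2t-nonZero = double-nonZero t≢0

    h : ℕ
    h = (t +ℕ t) *ℕ suc t

    q²≡2h+1 : q *ℕ q ≡ suc (h +ℕ h)
    q²≡2h+1 = ≡.trans (≡.cong₂ _*ℕ_ q≡2t+1 q≡2t+1) (square t)
      where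
        square : ∀ t → suc (t +ℕ t) *ℕ suc (t +ℕ t) ≡ suc ((t +ℕ t) *ℕ suc t +ℕ (t +ℕ t) *ℕ suc t)
        square = solve-∀

    instance
      h-nonZero : ℕ.NonZero h
      h-nonZero = ℕP.m*n≢0 (t +ℕ t) (suc t)

    2t<2h : t +ℕ t < h +ℕ h
    2t<2h = ≡.subst (t +ℕ t <_) (≡.sym (2h≡2t+2t[2t+1] t)) (ℕP.m<m+n (t +ℕ t) (ℕ.>-nonZero⁻¹ _ {{ℕP.m*n≢0 (t +ℕ t) _}}))
      where
        2h≡2t+2t[2t+1] : ∀ t → (t +ℕ t) *ℕ suc t +ℕ (t +ℕ t) *ℕ suc t ≡ (t +ℕ t) +ℕ (t +ℕ t) *ℕ suc (t +ℕ t)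
        2h≡2t+2t[2t+1] = solve-∀

    open FiniteField isField (≡.subst HasOrder q²≡2h+1 order) public

    1+1≉0 : 1# + 1# ≉ 0#
    1+1≉0 = odd⇒2≉0 1≉0 (odd-prime pr p≢2)

    module ^q = IsAdditive (^p^-additive k)

    ^q-involutive : ∀ x → (x ^ q) ^ q ≈ x
    ^q-involutive x = trans (^-assocʳ x q q) (trans (reflexive (≡.cong (x ^_) q²≡2h+1)) (fermat-^suc x))

    fixed⇒^2t≈1 : ∀ x → x ≉ 0# → x ^ q ≈ x → x ^ (t +ℕ t) ≈ 1#
    fixed⇒^2t≈1 x x≉0 x^q≈x = *-cancelˡ x≉0 (begin
      x ^ suc (t +ℕ t)    ≡⟨ ≡.cong (x ^_) (≡.sym q≡2t+1) ⟩
      x ^ q               ≈⟨ x^q≈x ⟩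
      x                   ≈⟨ sym (*-identityʳ x) ⟩
      x * 1#              ∎)

    inSubfield-resp : ∀ {x y} → x ≈ y → InSubfield q x → InSubfield q y
    inSubfield-resp x≈y x-fixed = trans (^-congˡ q (sym x≈y)) (trans x-fixed x≈y)

    inSubfield-neg : ∀ {x} → InSubfield q x → InSubfield q (- x)
    inSubfield-neg {x} x-fixed = trans (^q.-‿homo x) (-‿cong x-fixed)

    inSubfield-double : ∀ {x} → InSubfield q (x + x) → InSubfield q x
    inSubfield-double {x} 2x-fixed = double-injective 1+1≉0 (trans (sym (^q.homo x x)) 2x-fixed)

    inSubfield-trace : ∀ w → InSubfield q (w + w ^ q)
    inSubfield-trace w = trans (^q.homo w (w ^ q)) (trans (+-congˡ (^q-involutive w)) (+-comm _ _))

    inSubfield-norm : ∀ u → InSubfield q (Norm q u)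
    inSubfield-norm u = begin
      (u ^ (q +ℕ 1)) ^ q     ≈⟨ ^-congˡ q (^-+1 u q) ⟩
      (u ^ q * u) ^ q        ≈⟨ ^-distrib-* (u ^ q) u q ⟩
      (u ^ q) ^ q * u ^ q    ≈⟨ *-congʳ (^q-involutive u) ⟩
      u * u ^ q              ≈⟨ *-comm u (u ^ q) ⟩
      u ^ q * u              ≈⟨ sym (^-+1 u q) ⟩
      u ^ (q +ℕ 1)           ∎

    inSubfield-square : ∀ {x} → InSubfield q x → InSubfield q (x ^ 2)
    inSubfield-square {x} x-fixed = begin
      (x ^ 2) ^ q            ≈⟨ ^-assocʳ x 2 q ⟩
      x ^ (2 *ℕ q)           ≡⟨ ≡.cong (x ^_) (ℕP.*-comm 2 q) ⟩
      x ^ (q *ℕ 2)           ≈⟨ sym (^-assocʳ x q 2) ⟩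
      (x ^ q) ^ 2            ≈⟨ ^-congˡ 2 x-fixed ⟩
      x ^ 2                  ∎

    subfield-sqrt : ∀ D → D ≉ 0# → InSubfield q D → ∃[ s ] s * s ≈ D
    subfield-sqrt D D≉0 D-fixed = euler-criterion h ≡.refl D (begin
      D ^ ((t +ℕ t) *ℕ suc t)   ≈⟨ sym (^-assocʳ D (t +ℕ t) (suc t)) ⟩
      (D ^ (t +ℕ t)) ^ suc t    ≈⟨ ^-congˡ (suc t) (fixed⇒^2t≈1 D D≉0 D-fixed) ⟩
      1# ^ suc t                ≈⟨ 1#^ (suc t) ⟩
      1#                        ∎)

    ∃-non-subfield : ∃[ c ] c ^ q ≉ c
    ∃-non-subfield with any? (λ c → ¬? (c ^ q ≟ c)) (λ c≈d c-moved → c-moved ∘ inSubfield-resp (sym c≈d))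
    ... | yes non-fixed = non-fixed
    ... | no none = ⊥-elim (ℕP.<⇒≱ 2t<2h (all-roots⇒order≤ (t +ℕ t) all-roots))
      where
        all-fixed : ∀ x → x ^ q ≈ x
        all-fixed x = decidable-stable (x ^ q ≟ x) (λ x^q≉x → none (x , x^q≉x))
        all-roots : ∀ x → x ≉ 0# → x ^ (t +ℕ t) ≈ 1#
        all-roots x x≉0 = fixed⇒^2t≈1 x x≉0 (all-fixed x)

    -- Hilbert 90: a = 1 + τ^q works unless τ = -1, where any a with a^q = -a does.
    hilbert90 : ∀ τ → τ ^ q * τ ≈ 1# → ∃[ a ] a ≉ 0# × a ^ q ≈ τ * a
    hilbert90 τ norm≈1 with 1# + τ ^ q ≟ 0#
    ... | no a≉0 = 1# + τ ^ q , a≉0 , (begin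
      (1# + τ ^ q) ^ q          ≈⟨ ^q.homo 1# (τ ^ q) ⟩
      1# ^ q + (τ ^ q) ^ q      ≈⟨ +-cong (1#^ q) (^q-involutive τ) ⟩
      1# + τ                    ≈⟨ +-comm 1# τ ⟩
      τ + 1#                    ≈⟨ +-cong (sym (*-identityʳ τ)) (sym (trans (*-comm τ (τ ^ q)) norm≈1)) ⟩
      τ * 1# + τ * τ ^ q        ≈⟨ sym (distribˡ τ 1# (τ ^ q)) ⟩
      τ * (1# + τ ^ q)          ∎)
    ... | yes 1+τ^q≈0 = a , a≉0 , (begin
      (b - b ^ q) ^ q           ≈⟨ ^q.sub-homo b (b ^ q) ⟩
      b ^ q - (b ^ q) ^ q       ≈⟨ +-congˡ (-‿cong (^q-involutive b)) ⟩
      b ^ q - b                 ≈⟨ solve 2 (λ b B → B :- b := :- (b :- B)) refl b (b ^ q) ⟩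
      - (b - b ^ q)             ≈⟨ sym (-1*x≈-x _) ⟩
      - 1# * (b - b ^ q)        ≈⟨ *-congʳ (sym τ≈-1) ⟩
      τ * (b - b ^ q)           ∎)
      where
        b = proj₁ ∃-non-subfield
        a = b - b ^ q
        a≉0 : a ≉ 0#
        a≉0 a≈0 = proj₂ ∃-non-subfield (sym (x∙y⁻¹≈ε⇒x≈y b (b ^ q) a≈0))
        τ≈-1 : τ ≈ - 1#
        τ≈-1 = begin
          τ                     ≈⟨ sym (^q-involutive τ) ⟩
          (τ ^ q) ^ q           ≈⟨ ^-congˡ q (+-inverseʳ-unique 1# (τ ^ q) 1+τ^q≈0) ⟩
          (- 1#) ^ q            ≈⟨ ^q.-‿homo 1# ⟩
          - (1# ^ q)            ≈⟨ -‿cong (1#^ q) ⟩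
          - 1#                  ∎

    nonzeroSquareIn? : ∀ D → Dec (NonzeroSquareIn q D)
    nonzeroSquareIn? D = ¬? (D ≟ 0#) ×-dec any? (λ y → (y ^ q ≟ y) ×-dec (y * y ≟ D))
      (λ x≈y (x-fixed , x²≈D) → inSubfield-resp x≈y x-fixed , trans (*-cong (sym x≈y) (sym x≈y)) x²≈D)

    HasTraceNorm : Carrier → Carrier → Carrier → Set ℓ
    HasTraceNorm tr nm w = (w + w ^ q ≈ tr) × (Norm q w ≈ nm)

    completing-square : ∀ {L N w} → HasTraceNorm (- (L + L)) N w → (w + L) * (w + L) ≈ L ^ 2 - N
    completing-square {L} {N} {w} (trace , norm) = begin
      (w + L) * (w + L)                 ≈⟨ solve 2 (λ w L → (w :+ L) :* (w :+ L) := w :* w :+ (L :+ L) :* w :+ L :* L) refl w L ⟩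
      w * w + (L + L) * w + L * L       ≈⟨ +-congʳ (+-congˡ (*-congʳ 2L≈-trace)) ⟩
      w * w + - (w + w ^ q) * w + L * L ≈⟨ solve 3 (λ w W L → w :* w :+ (:- (w :+ W)) :* w :+ L :* L := L :* L :- W :* w) refl w (w ^ q) L ⟩
      L * L - w ^ q * w                 ≈⟨ +-cong (sym (x^2≈x*x L)) (-‿cong (trans (sym (^-+1 w q)) norm)) ⟩
      L ^ 2 - N                         ∎
      where 2L≈-trace = trans (sym (-‿involutive (L + L))) (-‿cong (sym trace))

    traceNorm⇒inSubfield : ∀ {L N w} → HasTraceNorm (- (L + L)) N w → InSubfield q L
    traceNorm⇒inSubfield {L} {w = w} (trace , _) = inSubfield-double
      (inSubfield-resp -trace≈2L (inSubfield-neg (inSubfield-trace w)))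
      where -trace≈2L = trans (-‿cong trace) (-‿involutive (L + L))

    traceNorm⇒¬nonzeroSquare : ∀ {L N w} → HasTraceNorm (- (L + L)) N w → ¬ NonzeroSquareIn q (L ^ 2 - N)
    traceNorm⇒¬nonzeroSquare {L} {N} {w} tn@(trace , norm) (D≉0 , y , y-fixed , y²≈D) = D≉0 (begin
      L ^ 2 - N                 ≈⟨ +-cong (x^2≈x*x L) (-‿cong (trans (sym norm) (trans (^-+1 w q) (*-congʳ w-fixed)))) ⟩
      L * L - w * w             ≈⟨ +-congʳ (*-cong L≈-w L≈-w) ⟩
      (- w) * (- w) - w * w     ≈⟨ solve 1 (λ w → (:- w) :* (:- w) :- w :* w := con (+ 0)) refl w ⟩
      0#                        ∎)
      where
        w+L-fixed : InSubfield q (w + L)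
        w+L-fixed = [ (λ w+L≈y → inSubfield-resp (sym w+L≈y) y-fixed)
                    , (λ w+L≈-y → inSubfield-resp (sym w+L≈-y) (inSubfield-neg y-fixed)) ]′
                    (x²≈y²⇒x≈±y (trans (completing-square tn) (sym y²≈D)))
        w-fixed : InSubfield q w
        w-fixed = +-cancelʳ L (w ^ q) w (begin
          w ^ q + L                 ≈⟨ +-congˡ (sym (traceNorm⇒inSubfield tn)) ⟩
          w ^ q + L ^ q             ≈⟨ sym (^q.homo w L) ⟩
          (w + L) ^ q               ≈⟨ w+L-fixed ⟩
          w + L                     ∎)
        L≈-w : L ≈ - w
        L≈-w = double-injective 1+1≉0 (begin
          L + L                     ≈⟨ sym (-‿involutive (L + L)) ⟩
          - - (L + L)               ≈⟨ -‿cong (sym trace) ⟩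
          - (w + w ^ q)             ≈⟨ -‿cong (+-congˡ w-fixed) ⟩
          - (w + w)                 ≈⟨ sym (-‿+-comm w w) ⟩
          - w + - w                 ∎)

    ¬nonzeroSquare⇒traceNorm : ∀ {L N} → InSubfield q L → InSubfield q N → ¬ NonzeroSquareIn q (L ^ 2 - N) →
                               ∃ (HasTraceNorm (- (L + L)) N)
    ¬nonzeroSquare⇒traceNorm {L} {N} L-fixed N-fixed ¬square with L ^ 2 - N ≟ 0#
    ... | yes D≈0 = - L , trans (+-congˡ -L-fixed) (-‿+-comm L L) , (begin
      (- L) ^ (q +ℕ 1)          ≈⟨ ^-+1 (- L) q ⟩
      (- L) ^ q * - L           ≈⟨ *-congʳ -L-fixed ⟩
      - L * - L                 ≈⟨ solve 1 (λ L → (:- L) :* (:- L) := L :* L) refl L ⟩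
      L * L                     ≈⟨ sym (x^2≈x*x L) ⟩
      L ^ 2                     ≈⟨ x∙y⁻¹≈ε⇒x≈y (L ^ 2) N D≈0 ⟩
      N                         ∎)
      where -L-fixed = inSubfield-neg L-fixed
    ... | no D≉0 = w , trace , norm
      where
        D = L ^ 2 - N
        D-fixed : InSubfield q D
        D-fixed = trans (^q.sub-homo (L ^ 2) N) (+-cong (inSubfield-square L-fixed) (-‿cong N-fixed))
        s = proj₁ (subfield-sqrt D D≉0 D-fixed)
        s²≈D = proj₂ (subfield-sqrt D D≉0 D-fixed)
        s^q≈-s : s ^ q ≈ - s
        s^q≈-s = [ (λ s^q≈s → contradiction (D≉0 , s , s^q≈s , s²≈D) ¬square) , (λ s^q≈-s → s^q≈-s) ]′
          (x²≈y²⇒x≈±y (begin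
            s ^ q * s ^ q           ≈⟨ sym (^-distrib-* s s q) ⟩
            (s * s) ^ q             ≈⟨ ^-congˡ q s²≈D ⟩
            D ^ q                   ≈⟨ D-fixed ⟩
            D                       ≈⟨ sym s²≈D ⟩
            s * s                   ∎))
        w = s - L
        w^q≈-s-L : w ^ q ≈ - s - L
        w^q≈-s-L = trans (^q.sub-homo s L) (+-cong s^q≈-s (-‿cong L-fixed))
        trace : w + w ^ q ≈ - (L + L)
        trace = trans (+-congˡ w^q≈-s-L) (solve 2 (λ s L → (s :- L) :+ (:- s :- L) := :- (L :+ L)) refl s L)
        norm : Norm q w ≈ N
        norm = begin
          w ^ (q +ℕ 1)              ≈⟨ ^-+1 w q ⟩
          w ^ q * w                 ≈⟨ *-congʳ w^q≈-s-L ⟩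
          (- s - L) * (s - L)       ≈⟨ solve 2 (λ s L → (:- s :- L) :* (s :- L) := L :* L :- s :* s) refl s L ⟩
          L * L - s * s             ≈⟨ +-cong (sym (x^2≈x*x L)) (-‿cong s²≈D) ⟩
          L ^ 2 - (L ^ 2 - N)       ≈⟨ solve 2 (λ A N → A :- (A :- N) := N) refl (L ^ 2) N ⟩
          N                         ∎

    module Planarity (bs : List Carrier) where

      lin : Carrier → Carrier
      lin = linEval p bs

      module lin = IsAdditive (linEval-additive bs)

      f : Carrier → Carrier
      f x = x ^ (q +ℕ 1) + lin (x ^ 2)

      Δ : Carrier → Carrier → Carrier
      Δ a x = f (x + a) - f x

      Λ : Carrier → Carrier → Carrier
      Λ a x = a * x ^ q + a ^ q * x + (lin (a * x) + lin (a * x))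

      Δ-cong : ∀ a → Congruent _≈_ _≈_ (Δ a)
      Δ-cong a x≈y = +-cong (f-cong (+-congʳ x≈y)) (-‿cong (f-cong x≈y))
        where
          f-cong : Congruent _≈_ _≈_ f
          f-cong x≈y = +-cong (^-congˡ (q +ℕ 1) x≈y) (lin.cong (^-congˡ 2 x≈y))

      Δ≈Λ+constant : ∀ a x → Δ a x ≈ Λ a x + (a ^ q * a + lin (a ^ 2))
      Δ≈Λ+constant a x = begin
        f (x + a) - f x
          ≈⟨ +-cong (+-cong (trans (^-+1 (x + a) q) (*-congʳ (^q.homo x a))) lin[x+a]²) (-‿cong (+-congʳ (^-+1 x q))) ⟩
        ((X + A) * (x + a) + (lin (x ^ 2) + ((l + l) + lin (a ^ 2)))) - (X * x + lin (x ^ 2))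
          ≈⟨ solve 7 (λ X A x a l₁ l l₂ → ((X :+ A) :* (x :+ a) :+ (l₁ :+ ((l :+ l) :+ l₂))) :- (X :* x :+ l₁)
                                          := (a :* X :+ A :* x :+ (l :+ l)) :+ (A :* a :+ l₂))
               refl X A x a (lin (x ^ 2)) l (lin (a ^ 2)) ⟩
        Λ a x + (A * a + lin (a ^ 2)) ∎
        where
          X = x ^ q
          A = a ^ q
          l = lin (a * x)
          [x+a]² : (x + a) ^ 2 ≈ x ^ 2 + ((a * x + a * x) + a ^ 2)
          [x+a]² = begin
            (x + a) ^ 2                         ≈⟨ x^2≈x*x (x + a) ⟩
            (x + a) * (x + a)                   ≈⟨ solve 2 (λ x a → (x :+ a) :* (x :+ a) := x :* x :+ ((a :* x :+ a :* x) :+ a :* a)) refl x a ⟩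
            x * x + ((a * x + a * x) + a * a)   ≈⟨ +-cong (sym (x^2≈x*x x)) (+-congˡ (sym (x^2≈x*x a))) ⟩
            x ^ 2 + ((a * x + a * x) + a ^ 2)   ∎
          lin[x+a]² : lin ((x + a) ^ 2) ≈ lin (x ^ 2) + ((l + l) + lin (a ^ 2))
          lin[x+a]² = trans (lin.cong [x+a]²) (trans (lin.homo _ _) (+-congˡ (trans (lin.homo _ _) (+-congʳ (lin.homo _ _)))))

      Λ-additive : ∀ a → IsAdditive (Λ a)
      Λ-additive a = record
        { cong = λ x≈y → +-cong (+-cong (*-congˡ (^-congˡ q x≈y)) (*-congˡ x≈y)) (+-cong (lin.cong (*-congˡ x≈y)) (lin.cong (*-congˡ x≈y)))
        ; homo = λ x y → begin
            a * (x + y) ^ q + A * (x + y) + (lin (a * (x + y)) + lin (a * (x + y)))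
              ≈⟨ +-cong (+-congʳ (*-congˡ (^q.homo x y))) (+-cong lin[ax+ay] lin[ax+ay]) ⟩
            a * (x ^ q + y ^ q) + A * (x + y) + ((lin (a * x) + lin (a * y)) + (lin (a * x) + lin (a * y)))
              ≈⟨ solve 8 (λ a A x y X Y u v → a :* (X :+ Y) :+ A :* (x :+ y) :+ ((u :+ v) :+ (u :+ v))
                                            := (a :* X :+ A :* x :+ (u :+ u)) :+ (a :* Y :+ A :* y :+ (v :+ v)))
                   refl a A x y (x ^ q) (y ^ q) (lin (a * x)) (lin (a * y)) ⟩
            Λ a x + Λ a y ∎
        }
        where
          A = a ^ q
          lin[ax+ay] : ∀ {x y} → lin (a * (x + y)) ≈ lin (a * x) + lin (a * y)
          lin[ax+ay] {x} {y} = trans (lin.cong (distribˡ a x y)) (lin.homo (a * x) (a * y))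

      TrivialKernels : Set (c ⊔ ℓ)
      TrivialKernels = ∀ a → a ≉ 0# → ∀ x → Λ a x ≈ 0# → x ≈ 0#

      planar⇒trivialKernels : Planar f → TrivialKernels
      planar⇒trivialKernels planar a a≉0 x Λ≈0 = proj₁ (planar a a≉0) (begin
        Δ a x                   ≈⟨ Δ≈Λ+constant a x ⟩
        Λ a x + K               ≈⟨ +-congʳ (trans Λ≈0 (sym (IsAdditive.0-homo (Λ-additive a)))) ⟩
        Λ a 0# + K              ≈⟨ sym (Δ≈Λ+constant a 0#) ⟩
        Δ a 0#                  ∎)
        where K = a ^ q * a + lin (a ^ 2)

      trivialKernels⇒planar : TrivialKernels → Planar f
      trivialKernels⇒planar trivial a a≉0 = injective , injective⇒surjective (Δ a) (Δ-cong a) injective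
        where
          K = a ^ q * a + lin (a ^ 2)
          injective : Injective _≈_ _≈_ (Δ a)
          injective {x} {y} Δx≈Δy = x∙y⁻¹≈ε⇒x≈y x y (trivial a a≉0 (x - y) (begin
            Λ a (x - y)         ≈⟨ IsAdditive.sub-homo (Λ-additive a) x y ⟩
            Λ a x - Λ a y       ≈⟨ x≈y⇒x∙y⁻¹≈ε (+-cancelʳ K _ _ (trans (sym (Δ≈Λ+constant a x)) (trans Δx≈Δy (Δ≈Λ+constant a y)))) ⟩
            0#                  ∎))

      planar⇔trivialKernels : Planar f ⇔ TrivialKernels
      planar⇔trivialKernels = mk⇔ planar⇒trivialKernels trivialKernels⇒planar

      kernel⇒traceNorm : ∀ a z → Λ a z ≈ 0# → HasTraceNorm (- (lin (a * z) + lin (a * z))) (Norm q (a * z)) (a ^ q * z)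
      kernel⇒traceNorm a z Λ≈0 = trace , norm
        where
          w = a ^ q * z
          l = lin (a * z)
          w^q≈az^q : w ^ q ≈ a * z ^ q
          w^q≈az^q = trans (^-distrib-* (a ^ q) z q) (*-congʳ (^q-involutive a))
          trace : w + w ^ q ≈ - (l + l)
          trace = +-inverseˡ-unique (w + w ^ q) (l + l) (begin
            (w + w ^ q) + (l + l)   ≈⟨ +-congʳ (trans (+-comm w (w ^ q)) (+-congʳ w^q≈az^q)) ⟩
            Λ a z                   ≈⟨ Λ≈0 ⟩
            0#                      ∎)
          norm : Norm q w ≈ Norm q (a * z)
          norm = begin
            w ^ (q +ℕ 1)            ≈⟨ ^-+1 w q ⟩
            w ^ q * w               ≈⟨ *-congʳ w^q≈az^q ⟩
            (a * z ^ q) * (a ^ q * z)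
              ≈⟨ solve 4 (λ a Z A z → (a :* Z) :* (A :* z) := (A :* Z) :* (a :* z)) refl a (z ^ q) (a ^ q) z ⟩
            (a ^ q * z ^ q) * (a * z) ≈⟨ *-congʳ (sym (^-distrib-* a z q)) ⟩
            (a * z) ^ q * (a * z)   ≈⟨ sym (^-+1 (a * z) q) ⟩
            (a * z) ^ (q +ℕ 1)      ∎

      -- Hilbert 90 turns w / u, which has norm 1, into a^(q-1); then x = u / a.
      traceNorm⇒kernel : ∀ u w → u ≉ 0# → HasTraceNorm (- (lin u + lin u)) (Norm q u) w →
                         ∃₂ λ a x → a ≉ 0# × x ≉ 0# × Λ a x ≈ 0#
      traceNorm⇒kernel u w u≉0 (trace , norm) = a , x , a≉0 , *-≉0 u≉0 (inverse-≉0 a a≉0) , (begin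
        a * x ^ q + a ^ q * x + (lin (a * x) + lin (a * x))
          ≈⟨ +-cong (+-cong ax^q≈w^q a^qx≈w) (+-cong (lin.cong ax≈u) (lin.cong ax≈u)) ⟩
        w ^ q + w + (lin u + lin u)   ≈⟨ +-congˡ 2l≈-trace ⟩
        w ^ q + w + - (w + w ^ q)     ≈⟨ solve 2 (λ W w → W :+ w :+ :- (w :+ W) := con (+ 0)) refl (w ^ q) w ⟩
        0#                            ∎)
        where
          u⁻¹ = inverse u u≉0
          τ = w * u⁻¹
          τ-norm : τ ^ q * τ ≈ 1#
          τ-norm = begin
            (w * u⁻¹) ^ q * (w * u⁻¹)          ≈⟨ *-congʳ (^-distrib-* w u⁻¹ q) ⟩
            (w ^ q * u⁻¹ ^ q) * (w * u⁻¹)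
              ≈⟨ solve 4 (λ W I w i → (W :* I) :* (w :* i) := (W :* w) :* (I :* i)) refl (w ^ q) (u⁻¹ ^ q) w u⁻¹ ⟩
            (w ^ q * w) * (u⁻¹ ^ q * u⁻¹)      ≈⟨ *-congʳ (trans (sym (^-+1 w q)) (trans norm (^-+1 u q))) ⟩
            (u ^ q * u) * (u⁻¹ ^ q * u⁻¹)
              ≈⟨ solve 4 (λ U I u i → (U :* u) :* (I :* i) := (U :* I) :* (u :* i)) refl (u ^ q) (u⁻¹ ^ q) u u⁻¹ ⟩
            (u ^ q * u⁻¹ ^ q) * (u * u⁻¹)      ≈⟨ *-cong (sym (^-distrib-* u u⁻¹ q)) (*-inverseʳ u u≉0) ⟩
            (u * u⁻¹) ^ q * 1#                 ≈⟨ *-identityʳ _ ⟩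
            (u * u⁻¹) ^ q                      ≈⟨ ^-congˡ q (*-inverseʳ u u≉0) ⟩
            1# ^ q                             ≈⟨ 1#^ q ⟩
            1#                                 ∎
          a = proj₁ (hilbert90 τ τ-norm)
          a≉0 = proj₁ (proj₂ (hilbert90 τ τ-norm))
          a^q≈τa = proj₂ (proj₂ (hilbert90 τ τ-norm))
          a⁻¹ = inverse a a≉0
          x = u * a⁻¹
          ax≈u : a * x ≈ u
          ax≈u = begin
            a * (u * a⁻¹)     ≈⟨ solve 3 (λ a u i → a :* (u :* i) := u :* (a :* i)) refl a u a⁻¹ ⟩
            u * (a * a⁻¹)     ≈⟨ *-congˡ (*-inverseʳ a a≉0) ⟩
            u * 1#            ≈⟨ *-identityʳ u ⟩
            u                 ∎
          a^qx≈w : a ^ q * x ≈ w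
          a^qx≈w = begin
            a ^ q * x         ≈⟨ *-congʳ a^q≈τa ⟩
            (τ * a) * x       ≈⟨ *-assoc τ a x ⟩
            τ * (a * x)       ≈⟨ *-congˡ ax≈u ⟩
            (w * u⁻¹) * u     ≈⟨ solve 3 (λ w i u → (w :* i) :* u := w :* (u :* i)) refl w u⁻¹ u ⟩
            w * (u * u⁻¹)     ≈⟨ *-congˡ (*-inverseʳ u u≉0) ⟩
            w * 1#            ≈⟨ *-identityʳ w ⟩
            w                 ∎
          ax^q≈w^q : a * x ^ q ≈ w ^ q
          ax^q≈w^q = begin
            a * x ^ q             ≈⟨ *-congʳ (sym (^q-involutive a)) ⟩
            (a ^ q) ^ q * x ^ q   ≈⟨ sym (^-distrib-* (a ^ q) x q) ⟩
            (a ^ q * x) ^ q       ≈⟨ ^-congˡ q a^qx≈w ⟩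
            w ^ q                 ∎
          2l≈-trace : lin u + lin u ≈ - (w + w ^ q)
          2l≈-trace = trans (sym (-‿involutive _)) (-‿cong (sym trace))

      DiscriminantCondition : Set (c ⊔ ℓ)
      DiscriminantCondition = ∀ u → u ≉ 0# → InSubfield q (lin u) → NonzeroSquareIn q (lin u ^ 2 - Norm q u)

      trivialKernels⇒discriminantCondition : TrivialKernels → DiscriminantCondition
      trivialKernels⇒discriminantCondition trivial u u≉0 l-fixed = decidable-stable (nonzeroSquareIn? _) λ ¬square →
        let w , tn = ¬nonzeroSquare⇒traceNorm l-fixed (inSubfield-norm u) ¬square
            a , x , a≉0 , x≉0 , Λ≈0 = traceNorm⇒kernel u w u≉0 tn
        in x≉0 (trivial a a≉0 x Λ≈0)

      discriminantCondition⇒trivialKernels : DiscriminantCondition → TrivialKernels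
      discriminantCondition⇒trivialKernels cond a a≉0 x Λ≈0 = decidable-stable (x ≟ 0#) λ x≉0 →
        traceNorm⇒¬nonzeroSquare tn (cond (a * x) (*-≉0 a≉0 x≉0) (traceNorm⇒inSubfield tn))
        where tn = kernel⇒traceNorm a x Λ≈0

      trivialKernels⇔discriminantCondition : TrivialKernels ⇔ DiscriminantCondition
      trivialKernels⇔discriminantCondition = mk⇔ trivialKernels⇒discriminantCondition discriminantCondition⇒trivialKernels

mainTheorem1 : ∀ {c ℓ : Level} (p k : ℕ) → Prime p → ¬ (p ≡ 2) → 1 ≤ k →
    (R : CommutativeRing c ℓ) →
    let open CommutativeRing R
        open FieldTheory R
        q = p ^ℕ k
    in IsField → HasOrder (q *ℕ q) → CharDivides p →
       (bs : List Carrier) →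
       Planar (λ x → x ^ (q +ℕ 1) + linEval p bs (x ^ 2))
       ⇔ (∀ u → u ≉ 0# → InSubfield q (linEval p bs u) →
            NonzeroSquareIn q (linEval p bs u ^ 2 - Norm q u))
mainTheorem1 p k pr p≢2 1≤k R isField order char bs =
  trivialKernels⇔discriminantCondition ⇔-∘ planar⇔trivialKernels
  where
    open QuadraticExtension R pr p≢2 k 1≤k isField order char
    open Planarity bs
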